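{- The generating set of the $2$-coloured operad $\mathrm{Bulle}$ is the set of the eight bubbles of arity $2$, namely $\{(c,w_1w_2): c,w_1,w_2\in\{1,2\}\}$.
   Context: $\mathrm{Bulle}$ is the $2$-coloured (non-symmetric, set-theoretic) operad defined as follows. Its elements of arity $n\ge2$ are the bubbles, i.e. pairs $(c,w)$ with $c\in\{1,2\}$ (the output colour) and $w=w_1\cdots w_n\in\{1,2\}^n$ (with $\mathrm{In}_i=w_i$). Its elements of arity $1$ are two units $\mathbb{1}_1,\mathbb{1}_2$, where $\mathbb{1}_c$ has output and input colour $c$. The composition $(c,u)\circ_i(d,v)$ is defined iff $u_i=d$, and then equals $(c,u_1\cdots u_{i-1}\,v\,u_{i+1}\cdots u_n)$. (Geometrically, a bubble is a regular polygon with vertices $1,\dots,n+1$ whose edges $(i,i+1)$ and base $(1,n+1)$ are each blue or uncoloured, with no coloured diagonals: $c=1$ iff the base is blue, and $w_i=2$ iff the $i$-th edge is blue.) A subset $G$ is the generating set of a coloured operad if the smallest coloured suboperad (subset closed under defined compositions and containing the units) containing $G$ is the whole operad, and $G$ is minimal for inclusion with this property. -}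

module Defs where

open import Data.Nat using (ℕ; zero; suc; _≤_)
open import Data.Fin using (Fin; toℕ)
open import Data.List using (List; []; _∷_; length; lookup; take; drop; _++_)
open import Data.Product using (Σ; ∃; _×_; _,_)
open import Data.Sum using (_⊎_)
open import Relation.Binary.PropositionalEquality using (_≡_)

data Colour : Set where
  col1 col2 : Colour

record Elem : Set where
  constructor ⟨_,_⟩
  field
    out : Colour
    ins : List Colour
open Elem public

arity : Elem → ℕ
arity x = length (ins x)

-- Elements of Bulle: bubbles (c , w) with |w| ≥ 2, and the units 𝟙_c = (c , c).
IsBulle : Elem → Set
IsBulle x = (2 ≤ length (ins x)) ⊎ (ins x ≡ out x ∷ [])

unit : Colour → Elem
unit c = ⟨ c , c ∷ [] ⟩

-- Partial composition x ∘_i y (positions 0-based as Fin (arity x));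
-- defined iff  lookup (ins x) i ≡ out y.
_∘[_]_ : (x : Elem) → Fin (arity x) → Elem → Elem
x ∘[ i ] y = ⟨ out x , take (toℕ i) (ins x) ++ ins y ++ drop (suc (toℕ i)) (ins x) ⟩

Composable : (x : Elem) → Fin (arity x) → Elem → Set
Composable x i y = lookup (ins x) i ≡ out y

Subset : Set₁
Subset = Elem → Set

_⊆_ : Subset → Subset → Set
A ⊆ B = ∀ x → A x → B x

record IsSuboperad (S : Subset) : Set where
  field
    sub   : S ⊆ IsBulle
    units : ∀ c → S (unit c)
    comp  : ∀ x (i : Fin (arity x)) y → S x → S y → Composable x i y → S (x ∘[ i ] y)

Generates : Subset → Set₁
Generates G = ∀ (S : Subset) → IsSuboperad S → G ⊆ S → IsBulle ⊆ S

IsGeneratingSet : Subset → Set₁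
IsGeneratingSet G =
  (G ⊆ IsBulle) × Generates G × (∀ (G' : Subset) → G' ⊆ G → Generates G' → G ⊆ G')

Arity2Bubbles : Subset
Arity2Bubbles x = Σ Colour λ c → Σ Colour λ w₁ → Σ Colour λ w₂ → x ≡ ⟨ c , w₁ ∷ w₂ ∷ [] ⟩

-- Every bubble of arity n ≥ 3 splits as (c, w₁ c) ∘₂ (c, w₂ ⋯ wₙ), so the arity-2
-- bubbles generate.  Conversely, a composite of two bubbles has arity at least 3,
-- and a composite with a unit is the other factor; hence for any G ⊆ Bulle the
-- elements of Bulle that are in G or have arity ≠ 2 form a suboperad, and a
-- generating G must already contain every bubble of arity 2.
module Submission where

open import Defs
open import Data.Nat using (suc; _≤_; _<_; _+_; s≤s; s≤s⁻¹; z≤n)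
open import Data.Nat.Properties using (+-suc; +-mono-≤; <⇒≤; <⇒≢)
open import Data.Fin using (Fin; toℕ; zero; suc)
open import Data.List using (List; []; _∷_; length; lookup; take; drop; _++_)
open import Data.List.Properties using (++-identityʳ; length-++)
open import Data.Product using (_×_; _,_; proj₁; proj₂)
open import Data.Sum using (inj₁; inj₂)
open import Data.Empty using (⊥-elim)
open import Relation.Binary.PropositionalEquality
  using (_≡_; refl; sym; trans; cong; subst)

take++lookup∷drop≡id : ∀ {A : Set} (xs : List A) (i : Fin (length xs)) →
                       take (toℕ i) xs ++ lookup xs i ∷ drop (suc (toℕ i)) xs ≡ xs
take++lookup∷drop≡id (x ∷ xs) zero    = refl
take++lookup∷drop≡id (x ∷ xs) (suc i) = cong (x ∷_) (take++lookup∷drop≡id xs i)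

arity-∘ : ∀ x (i : Fin (arity x)) y → suc (arity (x ∘[ i ] y)) ≡ arity y + arity x
arity-∘ ⟨ o , is ⟩ i ⟨ o' , js ⟩ = go is i
  where
  go : ∀ is (i : Fin (length is)) →
       suc (length (take (toℕ i) is ++ js ++ drop (suc (toℕ i)) is)) ≡ length js + length is
  go (a ∷ is) zero    = trans (cong suc (length-++ js)) (sym (+-suc (length js) (length is)))
  go (a ∷ is) (suc i) = trans (cong suc (go is i)) (sym (+-suc (length js) (length is)))

∘-identityˡ : ∀ x (i : Fin (arity x)) y →
              ins x ≡ out x ∷ [] → Composable x i y → x ∘[ i ] y ≡ y
∘-identityˡ ⟨ o , .(o ∷ []) ⟩ zero y refl refl = cong ⟨ out y ,_⟩ (++-identityʳ (ins y))

∘-identityʳ : ∀ x (i : Fin (arity x)) y →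
              ins y ≡ out y ∷ [] → Composable x i y → x ∘[ i ] y ≡ x
∘-identityʳ ⟨ o , is ⟩ i ⟨ .(lookup is i) , .(lookup is i ∷ []) ⟩ refl refl =
  cong ⟨ o ,_⟩ (take++lookup∷drop≡id is i)

arity-∘-bubbles : ∀ x (i : Fin (arity x)) y →
                  2 ≤ arity x → 2 ≤ arity y → 2 < arity (x ∘[ i ] y)
arity-∘-bubbles x i y 2≤x 2≤y =
  s≤s⁻¹ (subst (4 ≤_) (sym (arity-∘ x i y)) (+-mono-≤ 2≤y 2≤x))

bubble-split : ∀ c w₁ w₂ w₃ ws →
               ⟨ c , w₁ ∷ c ∷ [] ⟩ ∘[ suc zero ] ⟨ c , w₂ ∷ w₃ ∷ ws ⟩ ≡ ⟨ c , w₁ ∷ w₂ ∷ w₃ ∷ ws ⟩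
bubble-split c w₁ w₂ w₃ ws = cong (λ l → ⟨ c , w₁ ∷ l ⟩) (++-identityʳ (w₂ ∷ w₃ ∷ ws))

arity2Bubbles⊆Bulle : Arity2Bubbles ⊆ IsBulle
arity2Bubbles⊆Bulle _ (c , w₁ , w₂ , refl) = inj₁ (s≤s (s≤s z≤n))

arity2Bubbles-generate : Generates Arity2Bubbles
arity2Bubbles-generate S isS G⊆S = bulle⊆S
  where
  open IsSuboperad isS
  bubble∈S : ∀ c w₁ w₂ ws → S ⟨ c , w₁ ∷ w₂ ∷ ws ⟩
  bubble∈S c w₁ w₂ []        = G⊆S _ (c , w₁ , w₂ , refl)
  bubble∈S c w₁ w₂ (w₃ ∷ ws) =
    subst S (bubble-split c w₁ w₂ w₃ ws)
      (comp _ (suc zero) _ (G⊆S _ (c , w₁ , c , refl)) (bubble∈S c w₂ w₃ ws) refl)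
  bulle⊆S : IsBulle ⊆ S
  bulle⊆S ⟨ c , w₁ ∷ w₂ ∷ ws ⟩ _               = bubble∈S c w₁ w₂ ws
  bulle⊆S ⟨ c , .(c ∷ []) ⟩    (inj₂ refl)      = units c
  bulle⊆S ⟨ c , [] ⟩           (inj₁ ())
  bulle⊆S ⟨ c , w ∷ [] ⟩       (inj₁ (s≤s ()))

InOrArityNot2 : Subset → Subset
InOrArityNot2 G x = IsBulle x × (arity x ≡ 2 → G x)

inOrArityNot2-isSuboperad : ∀ G → IsSuboperad (InOrArityNot2 G)
inOrArityNot2-isSuboperad G = record
  { sub   = λ _ → proj₁
  ; units = λ c → inj₂ refl , λ ()
  ; comp  = comp
  }
  where
  comp : ∀ x (i : Fin (arity x)) y → InOrArityNot2 G x → InOrArityNot2 G y →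
         Composable x i y → InOrArityNot2 G (x ∘[ i ] y)
  comp x i y (inj₂ x-unit , _) y∈ e = subst (InOrArityNot2 G) (sym (∘-identityˡ x i y x-unit e)) y∈
  comp x i y x∈ (inj₂ y-unit , _) e = subst (InOrArityNot2 G) (sym (∘-identityʳ x i y y-unit e)) x∈
  comp x i y (inj₁ 2≤x , _) (inj₁ 2≤y , _) _ =
    inj₁ (<⇒≤ 2<xy) , λ xy≡2 → ⊥-elim (<⇒≢ 2<xy (sym xy≡2))
    where
    2<xy : 2 < arity (x ∘[ i ] y)
    2<xy = arity-∘-bubbles x i y 2≤x 2≤y

generating⊇arity2Bubbles : ∀ G → G ⊆ IsBulle → Generates G → Arity2Bubbles ⊆ G
generating⊇arity2Bubbles G G⊆Bulle gen x x∈@(_ , _ , _ , refl) =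
  proj₂ (gen (InOrArityNot2 G) (inOrArityNot2-isSuboperad G)
             (λ y y∈G → G⊆Bulle y y∈G , λ _ → y∈G)
             x (arity2Bubbles⊆Bulle x x∈))
        refl

mainTheorem6 : IsGeneratingSet Arity2Bubbles
mainTheorem6 =
    arity2Bubbles⊆Bulle
  , arity2Bubbles-generate
  , λ G G⊆arity2 gen →
      generating⊇arity2Bubbles G (λ x x∈ → arity2Bubbles⊆Bulle x (G⊆arity2 x x∈)) gen
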